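{- Let $n$ be a positive integer and let $m_1, m_2$ be integers with $\gcd(m_1,n)=\gcd(m_2,n)=1$. Then $12s(m_1/n)-12s(m_2/n)\in \mathbb{Z}$ if and only if $(m_1m_2-1)(m_1-m_2)\equiv 0 \pmod n$.
   Context: For a positive integer $n$ and an integer $m$ with $\gcd(m,n)=1$, the Dedekind sum is $s(m/n)=\sum_{k=1}^{n} ((k/n))((mk/n))$, where $((x))=x-\lfloor x\rfloor-1/2$ if $x\notin\mathbb{Z}$ and $((x))=0$ if $x\in\mathbb{Z}$ (the sawtooth function). -}

module Defs where

open import Data.Nat as ℕ using (ℕ; suc)
open import Data.Integer as ℤ using (ℤ; +_)
open import Data.Rational as ℚ using (ℚ; _/_; floor; ½; 0ℚ)
open import Data.List using (List; map; foldr; upTo)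
open import Data.Product using (∃)
open import Relation.Binary.PropositionalEquality using (_≡_)
open import Relation.Nullary using (yes; no)

saw : ℚ → ℚ
saw x with x ℚ.≟ (floor x / 1)
... | yes _ = 0ℚ
... | no  _ = x ℚ.- (floor x / 1) ℚ.- ½

-- Dedekind sum s(m/n) = Σ_{k=1}^{n} ((k/n)) ((m k / n)), for n = suc n'
dedekind : ℤ → (n : ℕ) → .{{_ : ℕ.NonZero n}} → ℚ
dedekind m n = foldr ℚ._+_ 0ℚ (map term (upTo n))
  where
  term : ℕ → ℚ
  term j = saw ((+ suc j) / n) ℚ.* saw ((m ℤ.* + suc j) / n)

IsInt : ℚ → Set
IsInt q = ∃ λ (z : ℤ) → q ≡ z / 1

-- With τ(0) = 0 and τ(r) = 2r − n for 0 < r < n, the sawtooth at p/n is τ(p mod n)/2n, so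
-- 4n²·s(m/n) = T(m) := Σ_{k<n} τ(k)·τ(mk mod n). For m invertible mod n, k ↦ mk mod n permutes the
-- residues, and comparing T(m) with Σ_k (mk − (mk mod n))² ≡ 0 (mod n²) by means of Σ k and Σ k²
-- gives 3m·T(m) ≡ n(1 + m²) (mod n²). Therefore 3m₁m₂(T(m₁) − T(m₂)) ≡ n(m₁m₂ − 1)(m₁ − m₂)
-- (mod n²), and since m₁m₂ is a unit mod n, 12(s(m₁/n) − s(m₂/n)) = 3(T(m₁) − T(m₂))/n² is an
-- integer exactly when n ∣ (m₁m₂ − 1)(m₁ − m₂).

module Submission where

open import Defs
open import Data.Nat as ℕ using (ℕ; zero; suc; s≤s; z<s)
import Data.Nat.Properties as ℕ
import Data.Nat.Divisibility as ℕ
import Data.Nat.Coprimality as ℕ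
import Data.Nat.GCD as ℕ
open import Data.Integer as ℤ using (ℤ; +_; -[1+_]; _+_; _-_; _*_; -_; 1ℤ)
import Data.Integer.Properties as ℤ
open import Data.Integer.Coprimality using (Coprime)
open import Data.Integer.DivMod using (_%_; n%d<d; a≡a%n+[a/n]*n) renaming (_/_ to _div_)
open import Data.Integer.Divisibility using (_∣_)
open import Data.Integer.Divisibility.Signed
  using (divides; ∣-refl; ∣-trans; ∣m∣n⇒∣m+n; ∣m∣n⇒∣m-n; ∣m⇒∣m*n; ∣n⇒∣m*n; ∣m⇒∣-m;
         ∣m+n∣m⇒∣n; *-monoʳ-∣; *-monoˡ-∣; *-cancelˡ-∣; ∣⇒∣ᵤ; ∣ᵤ⇒∣)
  renaming (_∣_ to _∣ₛ_)
open import Data.Integer.Tactic.RingSolver using (solve-∀)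
open import Data.Fin using (Fin; toℕ; fromℕ<)
import Data.Fin.Properties as Fin
open import Data.Fin.Permutation using (Permutation; permutation)
open import Data.List using (foldr; applyUpTo)
import Data.List.Properties as List
open import Data.Product using (∃; _×_; _,_)
open import Data.Rational as ℚ using (ℚ; _/_; mkℚ; floor; toℚᵘ; ½; 0ℚ)
import Data.Rational.Properties as ℚ
open import Data.Rational.Unnormalised as ℚᵘ using (mkℚᵘ) renaming (_≃_ to _≃ᵘ_)
import Data.Rational.Unnormalised.Properties as ℚᵘ
import Algebra.Properties.Semiring.Sum as SemiringSum
open import Function.Bundles using (_⇔_; mk⇔)
import Function.Properties.Equivalence as ⇔
open import Function.Base using (_∘_)
open import Relation.Binary.PropositionalEquality
open import Relation.Nullary using (yes; no; contradiction)

-- Fractions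

toℚᵘ-/ : ∀ p d .{{_ : ℕ.NonZero d}} → toℚᵘ (p / d) ≃ᵘ p ℚᵘ./ d
toℚᵘ-/ p (suc d) = ℚ.toℚᵘ-fromℚᵘ (mkℚᵘ p d)

p/a≡q/b⇒pb≡qa : ∀ p q a b .{{_ : ℕ.NonZero a}} .{{_ : ℕ.NonZero b}} →
                p / a ≡ q / b → p * + b ≡ q * + a
p/a≡q/b⇒pb≡qa p q a@(suc _) b@(suc _) eq = ℚᵘ.drop-*≡*
  (ℚᵘ.≃-trans (ℚᵘ.≃-sym (toℚᵘ-/ p a)) (ℚᵘ.≃-trans (ℚ.toℚᵘ-cong eq) (toℚᵘ-/ q b)))

pb≡qa⇒p/a≡q/b : ∀ p q a b .{{_ : ℕ.NonZero a}} .{{_ : ℕ.NonZero b}} →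
                p * + b ≡ q * + a → p / a ≡ q / b
pb≡qa⇒p/a≡q/b p q a@(suc _) b@(suc _) eq = ℚ.toℚᵘ-injective
  (ℚᵘ.≃-trans (toℚᵘ-/ p a) (ℚᵘ.≃-trans (ℚᵘ.*≡* eq) (ℚᵘ.≃-sym (toℚᵘ-/ q b))))

p/a+q/b≡[pb+qa]/ab : ∀ p q a b .{{_ : ℕ.NonZero a}} .{{_ : ℕ.NonZero b}} →
                     p / a ℚ.+ q / b ≡ _/_ (p * + b + q * + a) (a ℕ.* b) {{ℕ.m*n≢0 a b}}
p/a+q/b≡[pb+qa]/ab p q a@(suc _) b@(suc _) = ℚ.toℚᵘ-injective
  (ℚᵘ.≃-trans (ℚ.toℚᵘ-homo-+ (p / a) (q / b))
  (ℚᵘ.≃-trans (ℚᵘ.+-cong (toℚᵘ-/ p a) (toℚᵘ-/ q b)) (ℚᵘ.≃-sym (toℚᵘ-/ _ (a ℕ.* b)))))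

p/a*q/b≡pq/ab : ∀ p q a b .{{_ : ℕ.NonZero a}} .{{_ : ℕ.NonZero b}} →
                (p / a) ℚ.* (q / b) ≡ _/_ (p * q) (a ℕ.* b) {{ℕ.m*n≢0 a b}}
p/a*q/b≡pq/ab p q a@(suc _) b@(suc _) = ℚ.toℚᵘ-injective
  (ℚᵘ.≃-trans (ℚ.toℚᵘ-homo-* (p / a) (q / b))
  (ℚᵘ.≃-trans (ℚᵘ.*-cong (toℚᵘ-/ p a) (toℚᵘ-/ q b)) (ℚᵘ.≃-sym (toℚᵘ-/ _ (a ℕ.* b)))))

-[p/a]≡[-p]/a : ∀ p a .{{_ : ℕ.NonZero a}} → ℚ.- (p / a) ≡ (- p) / a
-[p/a]≡[-p]/a p a@(suc _) = ℚ.toℚᵘ-injective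
  (ℚᵘ.≃-trans (ℚ.toℚᵘ-homo‿- (p / a))
  (ℚᵘ.≃-trans (ℚᵘ.-‿cong (toℚᵘ-/ p a)) (ℚᵘ.≃-sym (toℚᵘ-/ _ a))))

p/a-q/b≡[pb-qa]/ab : ∀ p q a b .{{_ : ℕ.NonZero a}} .{{_ : ℕ.NonZero b}} →
                     p / a ℚ.- q / b ≡ _/_ (p * + b - q * + a) (a ℕ.* b) {{ℕ.m*n≢0 a b}}
p/a-q/b≡[pb-qa]/ab p q a b = begin
  p / a ℚ.- q / b                                  ≡⟨ cong (p / a ℚ.+_) (-[p/a]≡[-p]/a q b) ⟩
  p / a ℚ.+ (- q) / b                              ≡⟨ p/a+q/b≡[pb+qa]/ab p (- q) a b ⟩
  _/_ (p * + b + - q * + a) (a ℕ.* b) {{ab≢0}}     ≡⟨ cong (λ z → _/_ (p * + b + z) (a ℕ.* b) {{ab≢0}})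
                                                           (sym (ℤ.neg-distribˡ-* q (+ a))) ⟩
  _/_ (p * + b - q * + a) (a ℕ.* b) {{ab≢0}}       ∎
  where
  open ≡-Reasoning
  ab≢0 = ℕ.m*n≢0 a b

p/d+q/d≡[p+q]/d : ∀ p q d .{{_ : ℕ.NonZero d}} → p / d ℚ.+ q / d ≡ (p + q) / d
p/d+q/d≡[p+q]/d p q d = trans (p/a+q/b≡[pb+qa]/ab p q d d)
  (pb≡qa⇒p/a≡q/b (p * + d + q * + d) (p + q) (d ℕ.* d) d {{ℕ.m*n≢0 d d}} (begin
    (p * + d + q * + d) * + d   ≡⟨ factor p q (+ d) ⟩
    (p + q) * (+ d * + d)       ≡⟨ cong ((p + q) *_) (sym (ℤ.pos-* d d)) ⟩
    (p + q) * + (d ℕ.* d)       ∎))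
  where
  open ≡-Reasoning
  factor : ∀ p q d → (p * d + q * d) * d ≡ (p + q) * (d * d)
  factor = solve-∀

p/d-q/d≡[p-q]/d : ∀ p q d .{{_ : ℕ.NonZero d}} → p / d ℚ.- q / d ≡ (p - q) / d
p/d-q/d≡[p-q]/d p q d = trans (cong (p / d ℚ.+_) (-[p/a]≡[-p]/a q d)) (p/d+q/d≡[p+q]/d p (- q) d)

isInt-/⇔∣ : ∀ z d .{{_ : ℕ.NonZero d}} → IsInt (z / d) ⇔ (+ d ∣ₛ z)
isInt-/⇔∣ z d = mk⇔
  (λ (q , z/d≡q) → divides q (trans (sym (ℤ.*-identityʳ z)) (p/a≡q/b⇒pb≡qa z q d 1 z/d≡q)))
  (λ (divides q z≡qd) → q , pb≡qa⇒p/a≡q/b z q d 1 (trans (ℤ.*-identityʳ z) z≡qd))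

-- Finite sums over an initial segment of ℕ

module Sum = SemiringSum ℤ.+-*-semiring

∑< : ℕ → (ℕ → ℤ) → ℤ
∑< n f = Sum.sum {n} (λ i → f (toℕ i))

syntax ∑< n (λ k → e) = ∑[ k < n ] e

∑-cong : ∀ {f g : ℕ → ℤ} n → (∀ k → k ℕ.< n → f k ≡ g k) → ∑[ k < n ] f k ≡ ∑[ k < n ] g k
∑-cong n f≡g = Sum.sum-cong-≗ {n} (λ i → f≡g (toℕ i) (Fin.toℕ<n i))

∑-head : ∀ n .{{_ : ℕ.NonZero n}} (f : ℕ → ℤ) → ∑[ k < n ] f k ≡ f 0 + ∑[ k < ℕ.pred n ] f (suc k)
∑-head (suc n) f = refl

∑-snoc : ∀ (f : ℕ → ℤ) n → ∑[ k < suc n ] f k ≡ ∑[ k < n ] f k + f n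
∑-snoc f zero    = ℤ.+-comm (f 0) (+ 0)
∑-snoc f (suc n) =
  trans (cong (λ s → f 0 + s) (∑-snoc (λ k → f (suc k)) n)) (sym (ℤ.+-assoc (f 0) _ (f (suc n))))

∑-rotate : ∀ (f : ℕ → ℤ) n → f 0 ≡ f n → ∑[ k < n ] f (suc k) ≡ ∑[ k < n ] f k
∑-rotate f n f0≡fn = begin
  ∑[ k < n ] f (suc k)                   ≡⟨ add-sub (f 0) (∑[ k < n ] f (suc k)) ⟩
  f 0 + ∑[ k < n ] f (suc k) - f 0       ≡⟨ cong (_- f 0) (∑-snoc f n) ⟩
  ∑[ k < n ] f k + f n - f 0             ≡⟨ cong (λ z → ∑[ k < n ] f k + z - f 0) (sym f0≡fn) ⟩
  ∑[ k < n ] f k + f 0 - f 0             ≡⟨ sub-add (∑[ k < n ] f k) (f 0) ⟩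
  ∑[ k < n ] f k                         ∎
  where
  open ≡-Reasoning
  add-sub : ∀ a x → x ≡ a + x - a
  add-sub = solve-∀
  sub-add : ∀ x a → x + a - a ≡ x
  sub-add = solve-∀

∑-linear : ∀ a b (f g : ℕ → ℤ) n →
           ∑[ k < n ] (a * f k + b * g k) ≡ a * ∑[ k < n ] f k + b * ∑[ k < n ] g k
∑-linear a b f g n = trans (Sum.∑-distrib-+ {n} _ _)
  (sym (cong₂ _+_ (Sum.*-distribˡ-sum {n} a _) (Sum.*-distribˡ-sum {n} b _)))

∑-∣ : ∀ {d} (f : ℕ → ℤ) n → (∀ k → k ℕ.< n → d ∣ₛ f k) → d ∣ₛ ∑[ k < n ] f k
∑-∣ f zero    _    = divides (+ 0) refl
∑-∣ f (suc n) d∣f =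
  ∣m∣n⇒∣m+n (d∣f 0 z<s) (∑-∣ (λ k → f (suc k)) n (λ k k<n → d∣f (suc k) (s≤s k<n)))

∑-quadratic : ∀ a b c n →
  ∑[ k < n ] (+ 6 * a * (+ k * + k) + + 6 * b * + k + c)
    ≡ a * (+ n * (+ n - 1ℤ) * (+ 2 * + n - 1ℤ)) + + 3 * b * (+ n * (+ n - 1ℤ)) + c * + n
∑-quadratic a b c zero    = vanish a b c
  where
  vanish : ∀ a b c →
    + 0 ≡ a * (+ 0 * (+ 0 - 1ℤ) * (+ 2 * + 0 - 1ℤ)) + + 3 * b * (+ 0 * (+ 0 - 1ℤ)) + c * + 0
  vanish = solve-∀
∑-quadratic a b c (suc n) = begin
  ∑[ k < suc n ] summand k                           ≡⟨ ∑-snoc summand n ⟩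
  ∑[ k < n ] summand k + summand n                   ≡⟨ cong (_+ summand n) (∑-quadratic a b c n) ⟩
  closed-form (+ n) + summand n                      ≡⟨ step a b c (+ n) ⟩
  closed-form (1ℤ + + n)                             ∎
  where
  open ≡-Reasoning
  summand : ℕ → ℤ
  summand k = + 6 * a * (+ k * + k) + + 6 * b * + k + c
  closed-form : ℤ → ℤ
  closed-form x = a * (x * (x - 1ℤ) * (+ 2 * x - 1ℤ)) + + 3 * b * (x * (x - 1ℤ)) + c * x
  step : ∀ a b c x →
    a * (x * (x - 1ℤ) * (+ 2 * x - 1ℤ)) + + 3 * b * (x * (x - 1ℤ)) + c * x
      + (+ 6 * a * (x * x) + + 6 * b * x + c)
      ≡ a * ((1ℤ + x) * ((1ℤ + x) - 1ℤ) * (+ 2 * (1ℤ + x) - 1ℤ)) + + 3 * b * ((1ℤ + x) * ((1ℤ + x) - 1ℤ))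
        + c * (1ℤ + x)
  step = solve-∀

∑-permute : ∀ n {π π′ : ℕ → ℕ} →
            (∀ k → k ℕ.< n → π k ℕ.< n) → (∀ k → k ℕ.< n → π′ k ℕ.< n) →
            (∀ k → k ℕ.< n → π′ (π k) ≡ k) → (∀ k → k ℕ.< n → π (π′ k) ≡ k) →
            ∀ (g : ℕ → ℤ) → ∑[ k < n ] g (π k) ≡ ∑[ k < n ] g k
∑-permute n {π} {π′} π<n π′<n π′∘π≗id π∘π′≗id g = begin
  ∑[ k < n ] g (π k)                                ≡⟨ Sum.sum-cong-≗ {n} (λ i → cong g (sym (toℕ-σ i))) ⟩
  Sum.sum {n} (λ i → g (toℕ (σ i)))                 ≡⟨ sym (Sum.sum-permute (λ i → g (toℕ i)) P) ⟩
  ∑[ k < n ] g k                                    ∎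
  where
  open ≡-Reasoning
  σ σ′ : Fin n → Fin n
  σ  i = fromℕ< (π<n (toℕ i) (Fin.toℕ<n i))
  σ′ i = fromℕ< (π′<n (toℕ i) (Fin.toℕ<n i))
  toℕ-σ : ∀ i → toℕ (σ i) ≡ π (toℕ i)
  toℕ-σ i = Fin.toℕ-fromℕ< _
  toℕ-σ′ : ∀ i → toℕ (σ′ i) ≡ π′ (toℕ i)
  toℕ-σ′ i = Fin.toℕ-fromℕ< _
  P : Permutation n n
  P = permutation σ σ′
    (λ i → Fin.toℕ-injective
             (trans (toℕ-σ (σ′ i)) (trans (cong π (toℕ-σ′ i)) (π∘π′≗id (toℕ i) (Fin.toℕ<n i)))))
    (λ i → Fin.toℕ-injective
             (trans (toℕ-σ′ (σ i)) (trans (cong π′ (toℕ-σ i)) (π′∘π≗id (toℕ i) (Fin.toℕ<n i)))))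

sum-applyUpTo-/ : ∀ d .{{_ : ℕ.NonZero d}} (f : ℕ → ℚ) (g : ℕ → ℤ) n → (∀ k → f k ≡ g k / d) →
                  foldr ℚ._+_ 0ℚ (applyUpTo f n) ≡ (∑[ k < n ] g k) / d
sum-applyUpTo-/ d f g zero    _      = sym (ℚ.0/n≡0 d)
sum-applyUpTo-/ d f g (suc n) f≡g/d = begin
  f 0 ℚ.+ foldr ℚ._+_ 0ℚ (applyUpTo (λ k → f (suc k)) n)
    ≡⟨ cong₂ ℚ._+_ (f≡g/d 0) (sum-applyUpTo-/ d (f ∘ suc) (g ∘ suc) n (f≡g/d ∘ suc)) ⟩
  g 0 / d ℚ.+ (∑[ k < n ] g (suc k)) / d
    ≡⟨ p/d+q/d≡[p+q]/d (g 0) (∑[ k < n ] g (suc k)) d ⟩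
  (∑[ k < suc n ] g k) / d
    ∎
  where open ≡-Reasoning

-- Divisibility and residues

∣∧<⇒≡0 : ∀ {m k} → m ℕ.∣ k → k ℕ.< m → k ≡ 0
∣∧<⇒≡0 {k = zero}  _   _   = refl
∣∧<⇒≡0 {k = suc _} m∣k k<m = contradiction m∣k (ℕ.>⇒∤ k<m)

r*d≡s*n⇒0≤r<n : ∀ r {s d n} .{{_ : ℕ.NonZero n}} → s ℕ.< suc d → r * + suc d ≡ + s * + n →
                ∃ λ t → r ≡ + t × t ℕ.< n
r*d≡s*n⇒0≤r<n -[1+ k ] {s} {d} {n} _ eq with () ← trans eq (sym (ℤ.pos-* s n))
r*d≡s*n⇒0≤r<n (+ t) {s} {d} {n} s<d eq = t , refl , ℕ.*-cancelʳ-< (suc d) t n (begin-strict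
  t ℕ.* suc d  ≡⟨ ℤ.+-injective (trans (ℤ.pos-* t (suc d)) (trans eq (sym (ℤ.pos-* s n)))) ⟩
  s ℕ.* n      <⟨ ℕ.*-monoˡ-< n s<d ⟩
  suc d ℕ.* n  ≡⟨ ℕ.*-comm (suc d) n ⟩
  n ℕ.* suc d  ∎)
  where open ℕ.≤-Reasoning

*-mono-∣ : ∀ {a b c d} → a ∣ₛ b → c ∣ₛ d → a * c ∣ₛ b * d
*-mono-∣ {b = b} {c = c} a∣b c∣d = ∣-trans (*-monoˡ-∣ c a∣b) (*-monoʳ-∣ b c∣d)

*-unit-∣ : ∀ {d} u₁ m₁ u₂ m₂ → d ∣ₛ u₁ * m₁ - 1ℤ → d ∣ₛ u₂ * m₂ - 1ℤ →
           d ∣ₛ (u₁ * u₂) * (m₁ * m₂) - 1ℤ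
*-unit-∣ {d} u₁ m₁ u₂ m₂ d∣u₁m₁-1 d∣u₂m₂-1 =
  subst (d ∣ₛ_) (regroup u₁ m₁ u₂ m₂) (∣m∣n⇒∣m+n (∣n⇒∣m*n (u₁ * m₁) d∣u₂m₂-1) d∣u₁m₁-1)
  where
  regroup : ∀ u₁ m₁ u₂ m₂ → u₁ * m₁ * (u₂ * m₂ - 1ℤ) + (u₁ * m₁ - 1ℤ) ≡ (u₁ * u₂) * (m₁ * m₂) - 1ℤ
  regroup = solve-∀

²∣-cancel-unit : ∀ {d} w a {x} → d ∣ₛ w * a - 1ℤ → d * d ∣ₛ a * x → d * d ∣ₛ x
²∣-cancel-unit {d} w a {x} d∣wa-1 d²∣ax = subst (d * d ∣ₛ_) (regroup w a x)
  (∣m∣n⇒∣m+n (∣n⇒∣m*n (w * (+ 2 - w * a)) d²∣ax) (∣m⇒∣m*n x (*-mono-∣ d∣wa-1 d∣wa-1)))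
  where
  regroup : ∀ w a x → w * (+ 2 - w * a) * (a * x) + (w * a - 1ℤ) * (w * a - 1ℤ) * x ≡ x
  regroup = solve-∀

coprime⇒invertible : ∀ n (m : ℤ) → Coprime m (+ n) → ∃ λ u → + n ∣ₛ u * m - 1ℤ
coprime⇒invertible n (+ a) a⊥n = ℕ-invertible (ℕ.coprime-Bézout a⊥n)
  where
  ℕ-invertible : ℕ.Bézout.Identity 1 a n → ∃ λ u → + n ∣ₛ u * + a - 1ℤ
  ℕ-invertible (ℕ.Bézout.+- x y 1+yn≡xa) = + x , divides (+ y) (begin
    + x * + a - 1ℤ          ≡⟨ cong (_- 1ℤ) (sym (ℤ.pos-* x a)) ⟩
    + (x ℕ.* a) - 1ℤ        ≡⟨ cong (λ z → + z - 1ℤ) (sym 1+yn≡xa) ⟩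
    1ℤ + + (y ℕ.* n) - 1ℤ   ≡⟨ cancel (+ (y ℕ.* n)) ⟩
    + (y ℕ.* n)             ≡⟨ ℤ.pos-* y n ⟩
    + y * + n               ∎)
    where
    open ≡-Reasoning
    cancel : ∀ z → 1ℤ + z - 1ℤ ≡ z
    cancel = solve-∀
  ℕ-invertible (ℕ.Bézout.-+ x y 1+xa≡yn) = - + x , divides (- + y) (begin
    - + x * + a - 1ℤ        ≡⟨ negate (+ x) (+ a) ⟩
    - (1ℤ + + x * + a)      ≡⟨ cong (λ z → - (1ℤ + z)) (sym (ℤ.pos-* x a)) ⟩
    - + (1 ℕ.+ x ℕ.* a)     ≡⟨ cong (λ z → - + z) 1+xa≡yn ⟩
    - + (y ℕ.* n)           ≡⟨ cong -_ (ℤ.pos-* y n) ⟩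
    - (+ y * + n)           ≡⟨ ℤ.neg-distribˡ-* (+ y) (+ n) ⟩
    - + y * + n             ∎)
    where
    open ≡-Reasoning
    negate : ∀ x a → - x * a - 1ℤ ≡ - (1ℤ + x * a)
    negate = solve-∀
coprime⇒invertible n -[1+ a ] a⊥n with u , n∣ua-1 ← coprime⇒invertible n (+ suc a) a⊥n =
  - u , subst (+ n ∣ₛ_) (negate-both u (+ suc a)) n∣ua-1
  where
  negate-both : ∀ u a → u * a - 1ℤ ≡ - u * - a - 1ℤ
  negate-both = solve-∀

module _ (n : ℕ) .{{_ : ℕ.NonZero n}} where

  n∣a-a%n : ∀ a → + n ∣ₛ a - + (a % + n)
  n∣a-a%n a = divides (a div + n) (begin
    a - + (a % + n)                                 ≡⟨ cong (_- + (a % + n)) (a≡a%n+[a/n]*n a (+ n)) ⟩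
    + (a % + n) + a div + n * + n - + (a % + n)     ≡⟨ cancel (+ (a % + n)) (a div + n * + n) ⟩
    a div + n * + n                                 ∎)
    where
    open ≡-Reasoning
    cancel : ∀ r q → r + q - r ≡ q
    cancel = solve-∀

  residue-unique : ∀ {r s} → r ℕ.< n → s ℕ.< n → + n ∣ₛ + r - + s → r ≡ s
  residue-unique {r} {s} r<n s<n n∣r-s =
    ℤ.+-injective (ℤ.i-j≡0⇒i≡j (+ r) (+ s) (ℤ.∣i∣≡0⇒i≡0 (∣∧<⇒≡0 (∣⇒∣ᵤ n∣r-s) ∣r-s∣<n)))
    where
    ∣r-s∣<n : ℤ.∣ + r - + s ∣ ℕ.< n
    ∣r-s∣<n = ℕ.≤-<-trans (ℕ.≤-reflexive (cong ℤ.∣_∣ (ℤ.m-n≡m⊖n r s)))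
                (ℕ.≤-<-trans (ℤ.∣m⊝n∣≤m⊔n r s) (ℕ.⊔-lub r<n s<n))

  %-unique : ∀ a {r} → r ℕ.< n → + n ∣ₛ a - + r → a % + n ≡ r
  %-unique a {r} r<n n∣a-r = residue-unique (n%d<d a (+ n)) r<n
    (subst (+ n ∣ₛ_) (shift a (+ r) (+ (a % + n))) (∣m∣n⇒∣m-n n∣a-r (n∣a-a%n a)))
    where
    shift : ∀ a r s → (a - r) - (a - s) ≡ s - r
    shift = solve-∀

  k%n≡k : ∀ {k} → k ℕ.< n → + k % + n ≡ k
  k%n≡k {k} k<n = %-unique (+ k) k<n (divides (+ 0) (ℤ.+-inverseʳ (+ k)))

  n∣a⇒a%n≡0 : ∀ a → + n ∣ₛ a → a % + n ≡ 0
  n∣a⇒a%n≡0 a (divides q a≡qn) =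
    %-unique a (ℕ.>-nonZero⁻¹ n) (divides q (trans (ℤ.+-identityʳ a) a≡qn))

-- The sawtooth and the Dedekind sum at denominator n

-- 2n·((r/n)) for a residue 0 ≤ r < n
scaledSaw : ℕ → ℕ → ℤ
scaledSaw n zero    = + 0
scaledSaw n (suc r) = + 2 * + suc r - + n

module _ (n : ℕ) .{{_ : ℕ.NonZero n}} where

  private instance
    2n≢0 : ℕ.NonZero (2 ℕ.* n)
    2n≢0 = ℕ.m*n≢0 2 n

  p-⌊x⌋n≡p%n : ∀ p x → x ≡ p / n → p - floor x * + n ≡ + (p % + n)
  p-⌊x⌋n≡p%n p x@(mkℚ a d-1 _) x≡p/n =
    residue (r*d≡s*n⇒0≤r<n (p - f * N) (n%d<d a d) r*d≡[a%d]*n)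
    where
    N d f : ℤ
    N = + n
    d = + suc d-1
    f = floor x
    aN≡pd : a * N ≡ p * d
    aN≡pd = p/a≡q/b⇒pb≡qa a p (suc d-1) n (trans (ℚ.↥p/↧p≡p x) x≡p/n)
    r*d≡[a%d]*n : (p - f * N) * d ≡ + (a % d) * N
    r*d≡[a%d]*n = begin
      (p - f * N) * d                   ≡⟨ expand p f N d ⟩
      p * d - f * d * N                 ≡⟨ cong (_- f * d * N) (sym aN≡pd) ⟩
      a * N - f * d * N                 ≡⟨ cong (λ z → z * N - f * d * N) (a≡a%n+[a/n]*n a d) ⟩
      (+ (a % d) + f * d) * N - f * d * N  ≡⟨ collect (+ (a % d)) (f * d) N ⟩
      + (a % d) * N                     ∎
      where
      open ≡-Reasoning
      expand : ∀ p f N d → (p - f * N) * d ≡ p * d - f * d * N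
      expand = solve-∀
      collect : ∀ r q N → (r + q) * N - q * N ≡ r * N
      collect = solve-∀
    p-t≡fn : ∀ {t} → p - f * N ≡ t → p - t ≡ f * N
    p-t≡fn refl = p-[p-q]≡q p (f * N)
      where
      p-[p-q]≡q : ∀ p q → p - (p - q) ≡ q
      p-[p-q]≡q = solve-∀
    residue : (∃ λ t → p - f * N ≡ + t × t ℕ.< n) → p - f * N ≡ + (p % N)
    residue (t , r≡t , t<n) =
      trans r≡t (cong +_ (sym (%-unique n p t<n (divides f (p-t≡fn r≡t)))))

  saw-/ : ∀ p → saw (p / n) ≡ scaledSaw n (p % + n) / (2 ℕ.* n)
  saw-/ p with p / n ℚ.≟ floor (p / n) / 1 | p % + n | p-⌊x⌋n≡p%n p (p / n) refl
  ... | yes _       | zero  | _    = sym (ℚ.0/n≡0 (2 ℕ.* n))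
  ... | yes p/n≡f/1 | suc s | r≡1+s = contradiction (trans (sym r≡1+s) p-fn≡0) λ ()
    where
    f = floor (p / n)
    p-fn≡0 : p - f * + n ≡ + 0
    p-fn≡0 = trans (cong (_- f * + n) (trans (sym (ℤ.*-identityʳ p)) (p/a≡q/b⇒pb≡qa p f n 1 p/n≡f/1)))
               (ℤ.+-inverseʳ (f * + n))
  ... | no  p/n≢f/1 | zero  | r≡0  = contradiction
    (pb≡qa⇒p/a≡q/b p f n 1 (trans (ℤ.*-identityʳ p) (ℤ.i-j≡0⇒i≡j p (f * + n) r≡0))) p/n≢f/1
    where f = floor (p / n)
  ... | no  _       | suc s | r≡1+s = begin
    p / n ℚ.- f / 1 ℚ.- ½                          ≡⟨ cong (ℚ._- ½) (p/a-q/b≡[pb-qa]/ab p f n 1) ⟩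
    _/_ r (n ℕ.* 1) {{n1≢0}} ℚ.- + 1 / 2           ≡⟨ p/a-q/b≡[pb-qa]/ab r (+ 1) (n ℕ.* 1) 2 {{n1≢0}} ⟩
    _/_ num (n ℕ.* 1 ℕ.* 2) {{n12≢0}}              ≡⟨ pb≡qa⇒p/a≡q/b num τ (n ℕ.* 1 ℕ.* 2) (2 ℕ.* n) {{n12≢0}} cross ⟩
    τ / (2 ℕ.* n)                                  ∎
    where
    open ≡-Reasoning
    N = + n
    f = floor (p / n)
    τ = + 2 * + suc s - N
    r = p * + 1 - f * N
    num = r * + 2 - + 1 * + (n ℕ.* 1)
    n1≢0 = ℕ.m*n≢0 n 1
    n12≢0 = ℕ.m*n≢0 (n ℕ.* 1) 2 {{n1≢0}}
    cross : num * + (2 ℕ.* n) ≡ τ * + (n ℕ.* 1 ℕ.* 2)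
    cross = begin
      num * + (2 ℕ.* n)                                      ≡⟨ cong₂ (λ u v → (r * + 2 - + 1 * u) * v)
                                                                        (ℤ.pos-* n 1) (ℤ.pos-* 2 n) ⟩
      ((p * + 1 - f * N) * + 2 - + 1 * (N * + 1)) * (+ 2 * N)  ≡⟨ tidy p (f * N) N ⟩
      ((p - f * N) * + 2 - N) * (+ 2 * N)                    ≡⟨ cong (λ r → (r * + 2 - N) * (+ 2 * N)) r≡1+s ⟩
      (+ suc s * + 2 - N) * (+ 2 * N)                        ≡⟨ reorder (+ suc s) N ⟩
      τ * (N * + 1 * + 2)                                    ≡⟨ cong (τ *_) (sym (trans (ℤ.pos-* (n ℕ.* 1) 2)
                                                                                          (cong (_* + 2) (ℤ.pos-* n 1)))) ⟩
      τ * + (n ℕ.* 1 ℕ.* 2)                                  ∎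
      where
      tidy : ∀ p q N →
        ((p * + 1 - q) * + 2 - + 1 * (N * + 1)) * (+ 2 * N) ≡ ((p - q) * + 2 - N) * (+ 2 * N)
      tidy = solve-∀
      reorder : ∀ S N → (S * + 2 - N) * (+ 2 * N) ≡ (+ 2 * S - N) * (N * + 1 * + 2)
      reorder = solve-∀

  private instance
    [2n]²≢0 : ℕ.NonZero (2 ℕ.* n ℕ.* (2 ℕ.* n))
    [2n]²≢0 = ℕ.m*n≢0 (2 ℕ.* n) (2 ℕ.* n)

  T : ℤ → ℤ
  T m = ∑[ k < n ] (scaledSaw n k * scaledSaw n ((m * + k) % + n))

  dedekind≡T/[2n]² : ∀ m → dedekind m n ≡ T m / (2 ℕ.* n ℕ.* (2 ℕ.* n))
  dedekind≡T/[2n]² m = begin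
    dedekind m n                               ≡⟨ cong (foldr ℚ._+_ 0ℚ) (List.map-upTo term n) ⟩
    foldr ℚ._+_ 0ℚ (applyUpTo term n)          ≡⟨ sum-applyUpTo-/ D term (λ k → G (suc k)) n term≡G/D ⟩
    (∑[ k < n ] G (suc k)) / D                 ≡⟨ cong (λ z → z / D) (∑-rotate G n G0≡Gn) ⟩
    (∑[ k < n ] G k) / D                       ≡⟨ cong (λ z → z / D) (∑-cong n G≡T-summand) ⟩
    T m / D                                    ∎
    where
    open ≡-Reasoning
    D = 2 ℕ.* n ℕ.* (2 ℕ.* n)
    term : ℕ → ℚ
    term j = saw ((+ suc j) / n) ℚ.* saw ((m * + suc j) / n)
    G : ℕ → ℤ
    G k = scaledSaw n (+ k % + n) * scaledSaw n ((m * + k) % + n)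
    term≡G/D : ∀ j → term j ≡ G (suc j) / D
    term≡G/D j = trans (cong₂ ℚ._*_ (saw-/ (+ suc j)) (saw-/ (m * + suc j)))
      (p/a*q/b≡pq/ab (scaledSaw n (+ suc j % + n)) (scaledSaw n ((m * + suc j) % + n)) (2 ℕ.* n) (2 ℕ.* n))
    G0≡Gn : G 0 ≡ G n
    G0≡Gn = cong₂ (λ r s → scaledSaw n r * scaledSaw n s)
      (trans (k%n≡k n (ℕ.>-nonZero⁻¹ n)) (sym (n∣a⇒a%n≡0 n (+ n) ∣-refl)))
      (trans (n∣a⇒a%n≡0 n (m * + 0) (divides (+ 0) (ℤ.*-zeroʳ m)))
             (sym (n∣a⇒a%n≡0 n (m * + n) (∣n⇒∣m*n m ∣-refl))))
    G≡T-summand : ∀ k → k ℕ.< n → G k ≡ scaledSaw n k * scaledSaw n ((m * + k) % + n)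
    G≡T-summand k k<n = cong (λ r → scaledSaw n r * scaledSaw n ((m * + k) % + n)) (k%n≡k n k<n)

  %-*-inverse : ∀ m u → + n ∣ₛ u * m - 1ℤ → ∀ k → k ℕ.< n → (u * + ((m * + k) % + n)) % + n ≡ k
  %-*-inverse m u n∣um-1 k k<n = %-unique n (u * + p) k<n
    (subst (+ n ∣ₛ_) (regroup u m (+ p) (+ k))
      (∣m∣n⇒∣m+n (∣m⇒∣-m (∣n⇒∣m*n u (n∣a-a%n n (m * + k)))) (∣m⇒∣m*n (+ k) n∣um-1)))
    where
    p = (m * + k) % + n
    regroup : ∀ u m p k → - (u * (m * k - p)) + (u * m - 1ℤ) * k ≡ u * p - k
    regroup = solve-∀

  ∑-%-* : ∀ m u → + n ∣ₛ u * m - 1ℤ →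
          ∀ (g : ℕ → ℤ) → ∑[ k < n ] g ((m * + k) % + n) ≡ ∑[ k < n ] g k
  ∑-%-* m u n∣um-1 = ∑-permute n (λ k _ → n%d<d (m * + k) (+ n)) (λ k _ → n%d<d (u * + k) (+ n))
    (%-*-inverse m u n∣um-1) (%-*-inverse u m (subst (λ z → + n ∣ₛ z - 1ℤ) (ℤ.*-comm u m) n∣um-1))

  T+n²≡∑H : ∀ m u → + n ∣ₛ u * m - 1ℤ →
            T m + + n * + n ≡ ∑[ k < n ] ((+ 2 * + k - + n) * (+ 2 * + ((m * + k) % + n) - + n))
  T+n²≡∑H m u n∣um-1 = begin
    T m + N * N                                            ≡⟨ cong (_+ N * N) (∑-head n (λ k → τ k * τ (π k))) ⟩
    + 0 + ∑[ k < n-1 ] (τ (suc k) * τ (π (suc k))) + N * N ≡⟨ cong (λ z → + 0 + z + N * N) (∑-cong n-1 saws≡H) ⟩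
    + 0 + ∑[ k < n-1 ] H (suc k) + N * N                   ≡⟨ swap (∑[ k < n-1 ] H (suc k)) (N * N) ⟩
    N * N + ∑[ k < n-1 ] H (suc k)                         ≡⟨ cong (λ z → z + ∑[ k < n-1 ] H (suc k)) (sym H0≡n²) ⟩
    H 0 + ∑[ k < n-1 ] H (suc k)                           ≡⟨ sym (∑-head n H) ⟩
    ∑[ k < n ] H k                                         ∎
    where
    open ≡-Reasoning
    N = + n
    n-1 = ℕ.pred n
    τ = scaledSaw n
    π : ℕ → ℕ
    π k = (m * + k) % N
    H : ℕ → ℤ
    H k = (+ 2 * + k - N) * (+ 2 * + π k - N)
    π0≡0 : π 0 ≡ 0
    π0≡0 = n∣a⇒a%n≡0 n (m * + 0) (divides (+ 0) (ℤ.*-zeroʳ m))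
    H0≡n² : H 0 ≡ N * N
    H0≡n² = trans (cong (λ r → (+ 2 * + 0 - N) * (+ 2 * + r - N)) π0≡0) (square N)
      where
      square : ∀ N → (+ 2 * + 0 - N) * (+ 2 * + 0 - N) ≡ N * N
      square = solve-∀
    swap : ∀ x y → + 0 + x + y ≡ y + x
    swap = solve-∀
    saws≡H : ∀ k → k ℕ.< n-1 → τ (suc k) * τ (π (suc k)) ≡ H (suc k)
    saws≡H k k<n-1 with π (suc k) in πk≡r
    ... | suc _ = refl
    ... | zero  = contradiction (begin
      suc k                    ≡⟨ sym (%-*-inverse m u n∣um-1 (suc k) 1+k<n) ⟩
      (u * + π (suc k)) % N    ≡⟨ cong (λ r → (u * + r) % N) πk≡r ⟩
      (u * + 0) % N            ≡⟨ n∣a⇒a%n≡0 n (u * + 0) (divides (+ 0) (ℤ.*-zeroʳ u)) ⟩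
      0                        ∎) λ ()
      where
      1+k<n : suc k ℕ.< n
      1+k<n = subst (suc k ℕ.<_) (ℕ.suc-pred n) (s≤s k<n-1)

  defect : ℤ → ℤ
  defect m = ∑[ k < n ] ((m * + k - + ((m * + k) % + n)) * (m * + k - + ((m * + k) % + n)))

  n²∣defect : ∀ m → + n * + n ∣ₛ defect m
  n²∣defect m = ∑-∣ _ n (λ k _ → *-mono-∣ (n∣a-a%n n (m * + k)) (n∣a-a%n n (m * + k)))

  -- The mixed terms k·(mk mod n) cancel, and the sums over mk mod n are permuted sums over k.
  T-sum-identity : ∀ m u → + n ∣ₛ u * m - 1ℤ →
    + 3 * m * (T m + + n * + n) + + 6 * defect m
      ≡ (1ℤ + m * m) * (+ n * (+ n - 1ℤ) * (+ 2 * + n - 1ℤ)) - + 6 * m * + n * (+ n * (+ n - 1ℤ))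
        + + 3 * m * (+ n * + n) * + n
  T-sum-identity m u n∣um-1 = begin
    + 3 * m * (T m + N * N) + + 6 * defect m
                                                ≡⟨ cong (λ z → + 3 * m * z + + 6 * defect m) (T+n²≡∑H m u n∣um-1) ⟩
    + 3 * m * ∑[ k < n ] H k + + 6 * defect m   ≡⟨ ∑-linear (+ 3 * m) (+ 6) H e n ⟨
    ∑[ k < n ] (+ 3 * m * H k + + 6 * e k)      ≡⟨ ∑-cong n (λ k _ → expand m N (+ k) (+ π k)) ⟩
    ∑[ k < n ] (F (+ k) + G (+ π k))            ≡⟨ Sum.∑-distrib-+ {n} _ _ ⟩
    ∑[ k < n ] F (+ k) + ∑[ k < n ] G (+ π k)   ≡⟨ cong (λ s → ∑[ k < n ] F (+ k) + s) (∑-%-* m u n∣um-1 (G ∘ +_)) ⟩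
    ∑[ k < n ] F (+ k) + ∑[ k < n ] G (+ k)     ≡⟨ cong₂ _+_ (∑-quadratic (m * m) (- (m * N)) (+ 3 * m * (N * N)) n)
                                                              (∑-quadratic 1ℤ (- (m * N)) (+ 0) n) ⟩
    _                                           ≡⟨ combine m N ⟩
    (1ℤ + m * m) * (N * (N - 1ℤ) * (+ 2 * N - 1ℤ)) - + 6 * m * N * (N * (N - 1ℤ)) + + 3 * m * (N * N) * N ∎
    where
    open ≡-Reasoning
    N = + n
    π : ℕ → ℕ
    π k = (m * + k) % N
    H e : ℕ → ℤ
    H k = (+ 2 * + k - N) * (+ 2 * + π k - N)
    e k = (m * + k - + π k) * (m * + k - + π k)
    F G : ℤ → ℤ
    F k = + 6 * (m * m) * (k * k) + + 6 * (- (m * N)) * k + + 3 * m * (N * N)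
    G p = + 6 * 1ℤ * (p * p) + + 6 * (- (m * N)) * p + + 0
    expand : ∀ m N k p →
      + 3 * m * ((+ 2 * k - N) * (+ 2 * p - N)) + + 6 * ((m * k - p) * (m * k - p))
        ≡ (+ 6 * (m * m) * (k * k) + + 6 * (- (m * N)) * k + + 3 * m * (N * N))
          + (+ 6 * 1ℤ * (p * p) + + 6 * (- (m * N)) * p + + 0)
    expand = solve-∀
    combine : ∀ m N →
      (m * m) * (N * (N - 1ℤ) * (+ 2 * N - 1ℤ)) + + 3 * (- (m * N)) * (N * (N - 1ℤ)) + + 3 * m * (N * N) * N
        + (1ℤ * (N * (N - 1ℤ) * (+ 2 * N - 1ℤ)) + + 3 * (- (m * N)) * (N * (N - 1ℤ)) + + 0 * N)
        ≡ (1ℤ + m * m) * (N * (N - 1ℤ) * (+ 2 * N - 1ℤ)) - + 6 * m * N * (N * (N - 1ℤ)) + + 3 * m * (N * N) * N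
    combine = solve-∀

  T-congruence : ∀ m u → + n ∣ₛ u * m - 1ℤ → + n * + n ∣ₛ + 3 * m * T m - + n * (1ℤ + m * m)
  T-congruence m u n∣um-1 =
    subst (N * N ∣ₛ_) (sym 3mT-n[1+m²]≡n²K-6E)
      (∣m∣n⇒∣m-n (∣m⇒∣m*n K ∣-refl) (∣n⇒∣m*n (+ 6) (n²∣defect m)))
    where
    open ≡-Reasoning
    N E K : ℤ
    N = + n
    E = defect m
    K = (1ℤ + m * m) * (+ 2 * N - + 3) + + 3 * m - + 3 * m * N
    3mT-n[1+m²]≡n²K-6E : + 3 * m * T m - N * (1ℤ + m * m) ≡ N * N * K - + 6 * E
    3mT-n[1+m²]≡n²K-6E = begin
      + 3 * m * T m - N * (1ℤ + m * m)
        ≡⟨ isolate m N (T m) E ⟩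
      (+ 3 * m * (T m + N * N) + + 6 * E) - + 3 * m * (N * N) - N * (1ℤ + m * m) - + 6 * E
        ≡⟨ cong (λ z → z - + 3 * m * (N * N) - N * (1ℤ + m * m) - + 6 * E) (T-sum-identity m u n∣um-1) ⟩
      _
        ≡⟨ factor m N E ⟩
      N * N * K - + 6 * E
        ∎
      where
      isolate : ∀ m N T E → + 3 * m * T - N * (1ℤ + m * m)
                              ≡ (+ 3 * m * (T + N * N) + + 6 * E) - + 3 * m * (N * N) - N * (1ℤ + m * m) - + 6 * E
      isolate = solve-∀
      factor : ∀ m N E →
        (1ℤ + m * m) * (N * (N - 1ℤ) * (+ 2 * N - 1ℤ)) - + 6 * m * N * (N * (N - 1ℤ)) + + 3 * m * (N * N) * N
          - + 3 * m * (N * N) - N * (1ℤ + m * m) - + 6 * E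
          ≡ N * N * ((1ℤ + m * m) * (+ 2 * N - + 3) + + 3 * m - + 3 * m * N) - + 6 * E
      factor = solve-∀

  12s-12s≡12[T-T]/[2n]² : ∀ m₁ m₂ → (+ 12 / 1) ℚ.* dedekind m₁ n ℚ.- (+ 12 / 1) ℚ.* dedekind m₂ n
                                      ≡ (+ 12 * (T m₁ - T m₂)) / (2 ℕ.* n ℕ.* (2 ℕ.* n))
  12s-12s≡12[T-T]/[2n]² m₁ m₂ = begin
    c ℚ.* dedekind m₁ n ℚ.- c ℚ.* dedekind m₂ n
      ≡⟨ cong₂ (λ x y → c ℚ.* x ℚ.- c ℚ.* y) (dedekind≡T/[2n]² m₁) (dedekind≡T/[2n]² m₂) ⟩
    c ℚ.* (T m₁ / D) ℚ.- c ℚ.* (T m₂ / D)           ≡⟨ cong (c ℚ.* (T m₁ / D) ℚ.+_) (ℚ.neg-distribʳ-* c (T m₂ / D)) ⟩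
    c ℚ.* (T m₁ / D) ℚ.+ c ℚ.* ℚ.- (T m₂ / D)       ≡⟨ ℚ.*-distribˡ-+ c (T m₁ / D) (ℚ.- (T m₂ / D)) ⟨
    c ℚ.* (T m₁ / D ℚ.- T m₂ / D)                   ≡⟨ cong (c ℚ.*_) (p/d-q/d≡[p-q]/d (T m₁) (T m₂) D) ⟩
    c ℚ.* ((T m₁ - T m₂) / D)                       ≡⟨ p/a*q/b≡pq/ab (+ 12) (T m₁ - T m₂) 1 D ⟩
    _/_ (+ 12 * (T m₁ - T m₂)) (1 ℕ.* D) {{1D≢0}}
      ≡⟨ ℚ./-cong {p₁ = + 12 * (T m₁ - T m₂)} {{1D≢0}} refl (ℕ.*-identityˡ D) ⟩
    (+ 12 * (T m₁ - T m₂)) / D                      ∎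
    where
    open ≡-Reasoning
    c = + 12 / 1
    D = 2 ℕ.* n ℕ.* (2 ℕ.* n)
    1D≢0 = ℕ.m*n≢0 1 D

  [2n]²∣12x⇔n²∣3x : ∀ x → (+ (2 ℕ.* n ℕ.* (2 ℕ.* n)) ∣ₛ + 12 * x) ⇔ (+ n * + n ∣ₛ + 3 * x)
  [2n]²∣12x⇔n²∣3x x = mk⇔
    (λ h → *-cancelˡ-∣ (+ 4) (subst₂ _∣ₛ_ [2n]²≡4n² (twelve x) h))
    (λ h → subst₂ _∣ₛ_ (sym [2n]²≡4n²) (sym (twelve x)) (*-monoʳ-∣ (+ 4) h))
    where
    [2n]²≡4n² : + (2 ℕ.* n ℕ.* (2 ℕ.* n)) ≡ + 4 * (+ n * + n)
    [2n]²≡4n² = trans (ℤ.pos-* (2 ℕ.* n) (2 ℕ.* n))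
                (trans (cong₂ _*_ (ℤ.pos-* 2 n) (ℤ.pos-* 2 n)) (regroup (+ n)))
      where
      regroup : ∀ N → + 2 * N * (+ 2 * N) ≡ + 4 * (N * N)
      regroup = solve-∀
    twelve : ∀ x → + 12 * x ≡ + 4 * (+ 3 * x)
    twelve = solve-∀

  n²∣3[T-T]⇔n∣[m₁m₂-1][m₁-m₂] : ∀ m₁ m₂ u₁ u₂ → + n ∣ₛ u₁ * m₁ - 1ℤ → + n ∣ₛ u₂ * m₂ - 1ℤ →
    (+ n * + n ∣ₛ + 3 * (T m₁ - T m₂)) ⇔ (+ n ∣ₛ (m₁ * m₂ - 1ℤ) * (m₁ - m₂))
  n²∣3[T-T]⇔n∣[m₁m₂-1][m₁-m₂] m₁ m₂ u₁ u₂ n∣u₁m₁-1 n∣u₂m₂-1 = mk⇔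
    (λ h → *-cancelˡ-∣ N (∣m+n∣m⇒∣n (subst (N * N ∣ₛ_) key (∣n⇒∣m*n (m₁ * m₂) h)) n²∣P))
    (λ h → ²∣-cancel-unit (u₁ * u₂) (m₁ * m₂) (*-unit-∣ u₁ m₁ u₂ m₂ n∣u₁m₁-1 n∣u₂m₂-1)
             (subst (N * N ∣ₛ_) (sym key) (∣m∣n⇒∣m+n n²∣P (*-monoʳ-∣ N h))))
    where
    N = + n
    X₁ X₂ P : ℤ
    X₁ = + 3 * m₁ * T m₁ - N * (1ℤ + m₁ * m₁)
    X₂ = + 3 * m₂ * T m₂ - N * (1ℤ + m₂ * m₂)
    P = m₂ * X₁ - m₁ * X₂
    n²∣P : N * N ∣ₛ P
    n²∣P = ∣m∣n⇒∣m-n (∣n⇒∣m*n m₂ (T-congruence m₁ u₁ n∣u₁m₁-1))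
                     (∣n⇒∣m*n m₁ (T-congruence m₂ u₂ n∣u₂m₂-1))
    key : m₁ * m₂ * (+ 3 * (T m₁ - T m₂)) ≡ P + N * ((m₁ * m₂ - 1ℤ) * (m₁ - m₂))
    key = regroup m₁ m₂ (T m₁) (T m₂) N
      where
      regroup : ∀ m₁ m₂ T₁ T₂ N →
        m₁ * m₂ * (+ 3 * (T₁ - T₂))
          ≡ m₂ * (+ 3 * m₁ * T₁ - N * (1ℤ + m₁ * m₁)) - m₁ * (+ 3 * m₂ * T₂ - N * (1ℤ + m₂ * m₂))
            + N * ((m₁ * m₂ - 1ℤ) * (m₁ - m₂))
      regroup = solve-∀

theorem2 : (n : ℕ) .{{_ : ℕ.NonZero n}} (m₁ m₂ : ℤ) →
    Coprime m₁ (+ n) → Coprime m₂ (+ n) →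
    (IsInt ((+ 12 / 1) ℚ.* dedekind m₁ n ℚ.- (+ 12 / 1) ℚ.* dedekind m₂ n)
      ⇔ ((+ n) ∣ ((m₁ * m₂ - 1ℤ) * (m₁ - m₂))))
theorem2 n@(suc _) m₁ m₂ m₁⊥n m₂⊥n
  with u₁ , n∣u₁m₁-1 ← coprime⇒invertible n m₁ m₁⊥n
     | u₂ , n∣u₂m₂-1 ← coprime⇒invertible n m₂ m₂⊥n =
  subst (λ q → IsInt q ⇔ (+ n ∣ (m₁ * m₂ - 1ℤ) * (m₁ - m₂))) (sym (12s-12s≡12[T-T]/[2n]² n m₁ m₂))
    (⇔.trans (isInt-/⇔∣ (+ 12 * (T n m₁ - T n m₂)) (2 ℕ.* n ℕ.* (2 ℕ.* n)))
    (⇔.trans ([2n]²∣12x⇔n²∣3x n (T n m₁ - T n m₂))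
    (⇔.trans (n²∣3[T-T]⇔n∣[m₁m₂-1][m₁-m₂] n m₁ m₂ u₁ u₂ n∣u₁m₁-1 n∣u₂m₂-1)
             (mk⇔ ∣⇒∣ᵤ ∣ᵤ⇒∣))))
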